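{- Let $\mathbb H$ be a set of external-context-sharing hypersequent rules each having exactly one active component in each premiss. Every derivation $\mathcal D$ in $\mathrm{HLJ}+\mathbb H$ can be transformed into a derivation of the same end-hypersequent in which all applications of external contraction have ec-rank $0$.
   Context: $\mathrm{HLJ}$ is the hypersequent version of the propositional intuitionistic sequent calculus $\mathrm{LJ}$ (rules of $\mathrm{LJ}$ with a shared hypersequent context $G$, plus external weakening: from $G$ infer $G\mid\Gamma\Rightarrow\Pi$, and external contraction (EC): from $G\mid\Gamma\Rightarrow\Pi\mid\Gamma\Rightarrow\Pi$ infer $G\mid\Gamma\Rightarrow\Pi$). A hypersequent rule is external-context-sharing if its premisses are $G\mid C_1,\dots,G\mid C_n$ and its conclusion $G\mid H$ with the same $G$. The ec-rank of an application $E$ of (EC) in a derivation is the number of applications of rules other than (EC) between $E$ and the root of the derivation. -}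

module Defs where

open import Data.Nat using (ℕ; zero; suc)
open import Data.List using (List; []; _∷_; _++_; [_])
open import Data.List.Relation.Binary.Permutation.Propositional using (_↭_)
open import Data.List.Relation.Binary.Pointwise using (Pointwise)
open import Data.Maybe using (Maybe; just; nothing)
open import Data.Product using (Σ; _×_)
open import Relation.Binary.PropositionalEquality using (_≡_)

-- Propositional intuitionistic formulas (¬A is A ⊃ ⊥)

data Formula : Set where
  atom : ℕ → Formula
  ⊥'   : Formula
  _∧'_ : Formula → Formula → Formula
  _∨'_ : Formula → Formula → Formula
  _⊃_  : Formula → Formula → Formula

-- LJ sequents Γ ⇒ Π : Γ a multiset (list up to permutation),
-- Π at most one formula.

record Sequent : Set where
  constructor _⇒_
  field
    ante : List Formula
    succ : Maybe Formula

-- Hypersequents: multisets of sequents (lists up to the equivalence below)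
HSeq : Set
HSeq = List Sequent

_≈S_ : Sequent → Sequent → Set
(Γ ⇒ Π) ≈S (Γ' ⇒ Π') = (Γ ↭ Γ') × (Π ≡ Π')

_≈H_ : HSeq → HSeq → Set
H ≈H H' = Σ HSeq (λ K → Pointwise _≈S_ H K × (K ↭ H'))

-- The (internal) rules of LJ, as relations between the active sequents.

data LJ0 : Sequent → Set where
  init : ∀ A → LJ0 ([ A ] ⇒ just A)
  ⊥L   : ∀ Π → LJ0 ([ ⊥' ] ⇒ Π)

data LJ1 : Sequent → Sequent → Set where
  WL  : ∀ A Γ Π → LJ1 (Γ ⇒ Π) ((A ∷ Γ) ⇒ Π)
  WR  : ∀ A Γ → LJ1 (Γ ⇒ nothing) (Γ ⇒ just A)
  CL  : ∀ A Γ Π → LJ1 ((A ∷ A ∷ Γ) ⇒ Π) ((A ∷ Γ) ⇒ Π)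
  ∧L₁ : ∀ A B Γ Π → LJ1 ((A ∷ Γ) ⇒ Π) (((A ∧' B) ∷ Γ) ⇒ Π)
  ∧L₂ : ∀ A B Γ Π → LJ1 ((B ∷ Γ) ⇒ Π) (((A ∧' B) ∷ Γ) ⇒ Π)
  ∨R₁ : ∀ A B Γ → LJ1 (Γ ⇒ just A) (Γ ⇒ just (A ∨' B))
  ∨R₂ : ∀ A B Γ → LJ1 (Γ ⇒ just B) (Γ ⇒ just (A ∨' B))
  ⊃R  : ∀ A B Γ → LJ1 ((A ∷ Γ) ⇒ just B) (Γ ⇒ just (A ⊃ B))

data LJ2 : Sequent → Sequent → Sequent → Set where
  ∧R  : ∀ A B Γ → LJ2 (Γ ⇒ just A) (Γ ⇒ just B) (Γ ⇒ just (A ∧' B))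
  ∨L  : ∀ A B Γ Π → LJ2 ((A ∷ Γ) ⇒ Π) ((B ∷ Γ) ⇒ Π) (((A ∨' B) ∷ Γ) ⇒ Π)
  ⊃L  : ∀ A B Γ Δ Π → LJ2 (Γ ⇒ just A) ((B ∷ Δ) ⇒ Π) (((A ⊃ B) ∷ (Γ ++ Δ)) ⇒ Π)
  cut : ∀ A Γ Δ Π → LJ2 (Γ ⇒ just A) ((A ∷ Δ) ⇒ Π) ((Γ ++ Δ) ⇒ Π)

-- A set ℍ of external-context-sharing hypersequent rules with exactly one
-- active component in each premiss: ℍ Cs K holds iff
--     G | C₁   …   G | Cₙ
--           G | K
-- is an instance of a rule in ℍ (for every G), where Cs = C₁ … Cₙ.

HRules : Set₁
HRules = List Sequent → HSeq → Set

-- Every rule application may conclude any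
-- hypersequent equal (as a multiset of sequents with multiset antecedents)
-- to the schematic conclusion; this is not a separate rule.

mutual
  data Der (ℍ : HRules) : HSeq → Set where
    lj0 : ∀ {H} G {S} → LJ0 S → H ≈H (G ++ [ S ]) → Der ℍ H
    lj1 : ∀ {H} G {S₁ S} → LJ1 S₁ S → H ≈H (G ++ [ S ]) →
          Der ℍ (G ++ [ S₁ ]) → Der ℍ H
    lj2 : ∀ {H} G {S₁ S₂ S} → LJ2 S₁ S₂ S → H ≈H (G ++ [ S ]) →
          Der ℍ (G ++ [ S₁ ]) → Der ℍ (G ++ [ S₂ ]) → Der ℍ H
    ew  : ∀ {H} G S → H ≈H (G ++ [ S ]) → Der ℍ G → Der ℍ H
    ec  : ∀ {H} G S → H ≈H (G ++ [ S ]) →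
          Der ℍ (G ++ (S ∷ S ∷ [])) → Der ℍ H
    hr  : ∀ {H} G {Cs K} → ℍ Cs K → H ≈H (G ++ K) → Ders ℍ G Cs → Der ℍ H

  data Ders (ℍ : HRules) (G : HSeq) : List Sequent → Set where
    []  : Ders ℍ G []
    _∷_ : ∀ {C Cs} → Der ℍ (G ++ [ C ]) → Ders ℍ G Cs → Ders ℍ G (C ∷ Cs)

-- ec-ranks: ecRanksFrom k d lists the ec-ranks of all (EC) applications in
-- d, where k is the number of non-(EC) rule applications below the root
-- of d.

mutual
  ecRanksFrom : ∀ {ℍ H} → ℕ → Der ℍ H → List ℕ
  ecRanksFrom k (lj0 _ _ _)         = []
  ecRanksFrom k (lj1 _ _ _ d)       = ecRanksFrom (suc k) d
  ecRanksFrom k (lj2 _ _ _ d₁ d₂)   = ecRanksFrom (suc k) d₁ ++ ecRanksFrom (suc k) d₂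
  ecRanksFrom k (ew _ _ _ d)        = ecRanksFrom (suc k) d
  ecRanksFrom k (ec _ _ _ d)        = k ∷ ecRanksFrom k d
  ecRanksFrom k (hr _ _ _ ds)       = ecRanksFroms (suc k) ds

  ecRanksFroms : ∀ {ℍ G Cs} → ℕ → Ders ℍ G Cs → List ℕ
  ecRanksFroms k []       = []
  ecRanksFroms k (d ∷ ds) = ecRanksFrom k d ++ ecRanksFroms k ds

ecRanks : ∀ {ℍ H} → Der ℍ H → List ℕ
ecRanks = ecRanksFrom 0

module Submission where

-- Say that Z is derivable "up to copies of S" if, for some list Y of
-- sequents each equal to a component of S, the hypersequent Z | Y has a
-- derivation without any (EC).  The heart of the proof is that every
-- derivable H is derivable up to copies of H (`up-to-copies`); the missing
-- contractions can then all be performed at the root, where their ec-rank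
-- is 0 (`contract`).
--
-- `up-to-copies` is proved by induction on the derivation.  (EW) and (EC)
-- are easy: an (EC) is simply not performed, its extra copy joins Y.  Every
-- other rule is external-context-sharing with one active component per
-- premiss; its premisses come back as G | A | C, …, C with A copies of
-- components of G (`premiss-copies`, `common-context`).  Such a rule is
-- then applied to one copy of C, the remaining copies being carried along
-- as context; this produces duplicated conclusions K which join Y instead
-- of being contracted (`peel`, `multi-copy-rule`).

open import Defs
open import Data.Nat using (ℕ; zero; suc)
open import Data.Product using (Σ; _×_; _,_; proj₁; proj₂; uncurry)
open import Data.Sum using (inj₁; inj₂)
open import Data.List using (List; []; _∷_; _++_; [_]; replicate)
open import Data.List.Relation.Unary.All as All using (All; []; _∷_)
open import Data.List.Relation.Unary.All.Properties using () renaming (++⁺ to All-++⁺)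
open import Data.List.Relation.Unary.Any using (here; there)
open import Data.List.Relation.Binary.Permutation.Propositional
  using (_↭_; refl; prep; swap; trans; ↭-refl; ↭-sym; ↭-trans)
open import Data.List.Relation.Binary.Permutation.Propositional.Properties
  using (++⁺; ++-commutativeMonoid; shift; Any-resp-↭)
open import Data.List.Relation.Binary.Pointwise as Pointwise
  using (Pointwise; []; _∷_)
open import Data.List.Membership.Setoid.Properties using (∈-resp-≋; ∈-++⁺ˡ; ∈-++⁺ʳ; ∈-++⁻; ∈-∃++)
open import Relation.Binary.Bundles using (Setoid)
open import Relation.Binary.Core using (Rel)
open import Relation.Binary.PropositionalEquality
  using (_≡_; refl; sym; cong₂; subst) renaming (trans to ≡-trans)
open import Algebra.Solver.CommutativeMonoid (++-commutativeMonoid {A = Sequent})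
  using (solve; _⊜_; _⊕_; id)

Sequents : Setoid _ _
Sequents = record
  { Carrier       = Sequent
  ; _≈_           = _≈S_
  ; isEquivalence = record
    { refl  = ↭-refl , refl
    ; sym   = λ (Γ↭Γ' , Π≡Π') → ↭-sym Γ↭Γ' , sym Π≡Π'
    ; trans = λ (p , q) (p' , q') → ↭-trans p p' , ≡-trans q q' } }

open Setoid Sequents using () renaming (refl to ≈S-refl; sym to ≈S-sym; trans to ≈S-trans)
open import Data.List.Membership.Setoid Sequents using (_∈_)

_≋_ : Rel HSeq _
_≋_ = Pointwise _≈S_

-- A permutation followed by a pointwise relation can be rearranged into a
-- pointwise relation followed by a permutation; this is what makes the
-- composite relation _≈H_ transitive.
↭-Pointwise-commute : ∀ {a r} {A : Set a} {R : Rel A r} {xs ys zs : List A} →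
  xs ↭ ys → Pointwise R ys zs → Σ (List A) λ ws → Pointwise R xs ws × ws ↭ zs
↭-Pointwise-commute refl q = _ , q , ↭-refl
↭-Pointwise-commute (prep x p) (r ∷ q) with ↭-Pointwise-commute p q
... | ws , q' , p' = _ , r ∷ q' , prep _ p'
↭-Pointwise-commute (swap x y p) (r₁ ∷ r₂ ∷ q) with ↭-Pointwise-commute p q
... | ws , q' , p' = _ , r₂ ∷ r₁ ∷ q' , swap _ _ p'
↭-Pointwise-commute (trans p₁ p₂) q with ↭-Pointwise-commute p₂ q
... | ws₂ , q₂ , p₂' with ↭-Pointwise-commute p₁ q₂
... | ws₁ , q₁ , p₁' = ws₁ , q₁ , ↭-trans p₁' p₂'

≋⇒≈H : ∀ {H H'} → H ≋ H' → H ≈H H'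
≋⇒≈H q = _ , q , ↭-refl

↭⇒≈H : ∀ {H H'} → H ↭ H' → H ≈H H'
↭⇒≈H p = _ , Pointwise.refl ≈S-refl , p

≈H-refl : ∀ {H} → H ≈H H
≈H-refl = ↭⇒≈H ↭-refl

≈H-sym : ∀ {H H'} → H ≈H H' → H' ≈H H
≈H-sym (_ , q , p) = ↭-Pointwise-commute (↭-sym p) (Pointwise.symmetric ≈S-sym q)

≈H-trans : ∀ {H H' H''} → H ≈H H' → H' ≈H H'' → H ≈H H''
≈H-trans (_ , q₁ , p₁) (_ , q₂ , p₂) with ↭-Pointwise-commute p₁ q₂
... | _ , q , p = _ , Pointwise.transitive ≈S-trans q₁ q , ↭-trans p p₂

≈H-++ : ∀ {A A' B B'} → A ≈H A' → B ≈H B' → (A ++ B) ≈H (A' ++ B')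
≈H-++ (_ , q₁ , p₁) (_ , q₂ , p₂) = _ , Pointwise.++⁺ q₁ q₂ , ++⁺ p₁ p₂

≈H-∷ : ∀ {x y A B} → x ≈S y → A ≈H B → (x ∷ A) ≈H (y ∷ B)
≈H-∷ x≈y A≈B = ≈H-++ (≋⇒≈H (x≈y ∷ [])) A≈B

∈-resp-≈H : ∀ {x H H'} → H ≈H H' → x ∈ H → x ∈ H'
∈-resp-≈H (_ , q , p) m = Any-resp-↭ p (∈-resp-≋ Sequents q m)

Copies : HSeq → HSeq → Set
Copies S Y = All (_∈ S) Y

∈-left : ∀ {H G K x} → H ≈H (G ++ K) → x ∈ G → x ∈ H
∈-left H≈ m = ∈-resp-≈H (≈H-sym H≈) (∈-++⁺ˡ Sequents m)

∈-right : ∀ {H G K x} → H ≈H (G ++ K) → x ∈ K → x ∈ H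
∈-right {G = G} H≈ m = ∈-resp-≈H (≈H-sym H≈) (∈-++⁺ʳ Sequents G m)

copies-self : ∀ K → Copies K K
copies-self []      = []
copies-self (k ∷ K) = here ≈S-refl ∷ All.map there (copies-self K)

module _ {ℍ : HRules} where

  transport : ∀ {H H'} → H ≈H H' → Der ℍ H' → Der ℍ H
  transport q (lj0 G r p)     = lj0 G r (≈H-trans q p)
  transport q (lj1 G r p d)   = lj1 G r (≈H-trans q p) d
  transport q (lj2 G r p d e) = lj2 G r (≈H-trans q p) d e
  transport q (ew G S p d)    = ew G S (≈H-trans q p) d
  transport q (ec G S p d)    = ec G S (≈H-trans q p) d
  transport q (hr G h p ds)   = hr G h (≈H-trans q p) ds

  transport-ranks : ∀ {H H'} (q : H ≈H H') (d : Der ℍ H') k →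
    ecRanksFrom k (transport q d) ≡ ecRanksFrom k d
  transport-ranks q (lj0 G r p)     k = refl
  transport-ranks q (lj1 G r p d)   k = refl
  transport-ranks q (lj2 G r p d e) k = refl
  transport-ranks q (ew G S p d)    k = refl
  transport-ranks q (ec G S p d)    k = refl
  transport-ranks q (hr G h p ds)   k = refl

  RankZero : ∀ {H} → Der ℍ H → Set
  RankZero d = All (λ r → r ≡ 0) (ecRanks d)

  transport-RankZero : ∀ {H H'} (q : H ≈H H') (d : Der ℍ H') → RankZero d → RankZero (transport q d)
  transport-RankZero q d = subst (All _) (sym (transport-ranks q d 0))

  ECFree : ∀ {H} → Der ℍ H → Set
  ECFree d = ∀ k → ecRanksFrom k d ≡ []

  ECFree⇒RankZero : ∀ {H} (d : Der ℍ H) → ECFree d → RankZero d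
  ECFree⇒RankZero d free = subst (All _) (sym (free 0)) []

  Der₀ : HSeq → Set
  Der₀ H = Σ (Der ℍ H) ECFree

  transport₀ : ∀ {H H'} → H ≈H H' → Der₀ H' → Der₀ H
  transport₀ q (d , free) = transport q d , λ k → ≡-trans (transport-ranks q d k) (free k)

  rearrange₀ : ∀ {H H'} → H ↭ H' → Der₀ H' → Der₀ H
  rearrange₀ p = transport₀ (↭⇒≈H p)

  weaken₀ : ∀ {H} W → Der₀ H → Der₀ (H ++ W)
  weaken₀ {H} []      d = rearrange₀ (solve 1 (λ h → (h ⊕ id) ⊜ h) ↭-refl H) d
  weaken₀ {H} (S ∷ W) (d , free) =
    rearrange₀ (solve 3 (λ h s w → (h ⊕ (s ⊕ w)) ⊜ ((h ⊕ s) ⊕ w)) ↭-refl H [ S ] W)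
      (weaken₀ W (ew H S ≈H-refl d , λ k → free (suc k)))

  extend₀ : ∀ {H H'} W → H' ↭ (H ++ W) → Der₀ H → Der₀ H'
  extend₀ W p d = rearrange₀ p (weaken₀ W d)

  -- An external-context-sharing rule with premiss components Cs and
  -- conclusion components K, as an operation on EC-free derivations.
  Rule : List Sequent → HSeq → Set
  Rule Cs K = ∀ Z → All (λ C → Der₀ (Z ++ [ C ])) Cs → Der₀ (Z ++ K)

  lj0-rule : ∀ {S} → LJ0 S → Rule [] [ S ]
  lj0-rule r Z [] = lj0 Z r ≈H-refl , λ k → refl

  lj1-rule : ∀ {S₁ S} → LJ1 S₁ S → Rule [ S₁ ] [ S ]
  lj1-rule r Z ((d , free) ∷ []) = lj1 Z r ≈H-refl d , λ k → free (suc k)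

  lj2-rule : ∀ {S₁ S₂ S} → LJ2 S₁ S₂ S → Rule (S₁ ∷ S₂ ∷ []) [ S ]
  lj2-rule r Z ((d₁ , free₁) ∷ (d₂ , free₂) ∷ []) =
    lj2 Z r ≈H-refl d₁ d₂ , λ k → cong₂ _++_ (free₁ (suc k)) (free₂ (suc k))

  ders₀ : ∀ {Z Cs} → All (λ C → Der₀ (Z ++ [ C ])) Cs →
    Σ (Ders ℍ Z Cs) λ ds → ∀ k → ecRanksFroms k ds ≡ []
  ders₀ []                = [] , λ k → refl
  ders₀ ((d , free) ∷ ps) with ders₀ ps
  ... | ds , frees = d ∷ ds , λ k → cong₂ _++_ (free k) (frees k)

  hr-rule : ∀ {Cs K} → ℍ Cs K → Rule Cs K
  hr-rule h Z ps = hr Z h ≈H-refl (proj₁ (ders₀ ps)) , λ k → proj₂ (ders₀ ps) (suc k)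

  UpTo : HSeq → HSeq → Set
  UpTo S Z = Σ HSeq λ Y → Copies S Y × Der₀ (Z ++ Y)

  upTo-transport : ∀ {S Z Z'} → Z ≈H Z' → UpTo S Z' → UpTo S Z
  upTo-transport q (Y , c , d) = Y , c , transport₀ (≈H-++ q ≈H-refl) d

  upTo-rearrange : ∀ {S Z Z'} → Z ↭ Z' → UpTo S Z' → UpTo S Z
  upTo-rearrange p = upTo-transport (↭⇒≈H p)

  upTo-mono : ∀ {S S' Z} → (∀ {x} → x ∈ S → x ∈ S') → UpTo S Z → UpTo S' Z
  upTo-mono S⊆S' (Y , c , d) = Y , All.map S⊆S' c , d

  upTo-weaken : ∀ {S Z} W → UpTo S Z → UpTo S (Z ++ W)
  upTo-weaken {Z = Z} W (Y , c , d) =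
    Y , c , extend₀ W (solve 3 (λ z w y → ((z ⊕ w) ⊕ y) ⊜ ((z ⊕ y) ⊕ w)) ↭-refl Z W Y) d

  upTo-absorb : ∀ {S Z V} → Copies S V → UpTo S (Z ++ V) → UpTo S Z
  upTo-absorb {Z = Z} {V} cV (Y , c , d) =
    V ++ Y , All-++⁺ cV c , rearrange₀ (solve 3 (λ z v y → (z ⊕ (v ⊕ y)) ⊜ ((z ⊕ v) ⊕ y)) ↭-refl Z V Y) d

  MultiPremiss : HSeq → Sequent → Set
  MultiPremiss Z C = Σ ℕ λ a → Der₀ (Z ++ replicate (suc a) C)

  multiPremiss-extend : ∀ {Z Z' C} W → Z' ↭ (Z ++ W) → MultiPremiss Z C → MultiPremiss Z' C
  multiPremiss-extend {Z} {C = C} W Z'↭ (a , d) =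
    a , extend₀ W (↭-trans (++⁺ Z'↭ ↭-refl)
                    (solve 3 (λ z w r → ((z ⊕ w) ⊕ r) ⊜ ((z ⊕ r) ⊕ w)) ↭-refl Z W (replicate (suc a) C))) d

  split-copies : ∀ G C {X} → Copies (G ++ [ C ]) X →
    Σ HSeq λ A → Σ ℕ λ n → Copies G A × X ≈H (A ++ replicate n C)
  split-copies G C [] = [] , zero , [] , ≈H-refl
  split-copies G C {x ∷ X} (m ∷ ms) with split-copies G C ms | ∈-++⁻ Sequents G m
  ... | A , n , cA , X≈ | inj₁ x∈G = x ∷ A , n , x∈G ∷ cA , ≈H-∷ ≈S-refl X≈
  ... | A , n , cA , X≈ | inj₂ (here x≈C) =
    A , suc n , cA , ≈H-trans (≈H-∷ x≈C X≈) (↭⇒≈H (↭-sym (shift C A (replicate n C))))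

  premiss-copies : ∀ {G C} → UpTo (G ++ [ C ]) (G ++ [ C ]) →
    Σ HSeq λ A → Copies G A × MultiPremiss (G ++ A) C
  premiss-copies {G} {C} (X , c , d) with split-copies G C c
  ... | A , n , cA , X≈ = A , cA , n , transport₀ eq d
    where
    eq : ((G ++ A) ++ C ∷ replicate n C) ≈H ((G ++ [ C ]) ++ X)
    eq = ≈H-trans
      (↭⇒≈H (solve 4 (λ g a c r → ((g ⊕ a) ⊕ (c ⊕ r)) ⊜ ((g ⊕ c) ⊕ (a ⊕ r))) ↭-refl G A [ C ] (replicate n C)))
      (≈H-++ ≈H-refl (≈H-sym X≈))

  common-context : ∀ {G Cs} → All (λ C → Σ HSeq λ A → Copies G A × MultiPremiss (G ++ A) C) Cs →
    Σ HSeq λ A → Copies G A × All (MultiPremiss (G ++ A)) Cs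
  common-context [] = [] , [] , []
  common-context {G} ((A₁ , c₁ , p₁) ∷ ps) with common-context ps
  ... | A , c , qs =
    A₁ ++ A , All-++⁺ c₁ c ,
    multiPremiss-extend A (solve 3 (λ g b a → (g ⊕ (b ⊕ a)) ⊜ ((g ⊕ b) ⊕ a)) ↭-refl G A₁ A) p₁ ∷
    All.map (multiPremiss-extend A₁ (solve 3 (λ g b a → (g ⊕ (b ⊕ a)) ⊜ ((g ⊕ a) ⊕ b)) ↭-refl G A₁ A)) qs

  -- Applying a rule with conclusion K to premisses with several copies of
  -- their active components.  Contexts extending B are written B ++ W ++ T.
  module _ {K : HSeq} where

    -- One premiss with a+1 copies of C: apply the rule to one copy with the
    -- other a copies as context, then recursively to the remaining copies
    -- with the produced K | Y₁ as context; K | Y₁ are then copies of K.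
    peel : ∀ {B C} → (∀ W → Der₀ (B ++ W ++ [ C ]) → UpTo K (B ++ W ++ K)) →
      ∀ a W → Der₀ (B ++ W ++ replicate (suc a) C) → UpTo K (B ++ W ++ K)
    peel step zero    W d = step W d
    peel {B} {C} step (suc a) W d = continue (step (W ++ R) (rearrange₀ toSingle d))
      where
      R = replicate (suc a) C
      toSingle : (B ++ (W ++ R) ++ [ C ]) ↭ (B ++ W ++ C ∷ R)
      toSingle = solve 4 (λ b w r c → (b ⊕ ((w ⊕ r) ⊕ c)) ⊜ (b ⊕ (w ⊕ (c ⊕ r)))) ↭-refl B W R [ C ]
      continue : UpTo K (B ++ (W ++ R) ++ K) → UpTo K (B ++ W ++ K)
      continue (Y₁ , c₁ , d₁) =
        upTo-absorb (All-++⁺ (copies-self K) c₁)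
          (upTo-rearrange toResult (peel {B} {C} step a (W ++ K ++ Y₁) (rearrange₀ toRest d₁)))
        where
        toRest : (B ++ (W ++ K ++ Y₁) ++ R) ↭ ((B ++ (W ++ R) ++ K) ++ Y₁)
        toRest = solve 5 (λ b w k y r → (b ⊕ ((w ⊕ (k ⊕ y)) ⊕ r)) ⊜ ((b ⊕ ((w ⊕ r) ⊕ k)) ⊕ y)) ↭-refl B W K Y₁ R
        toResult : ((B ++ W ++ K) ++ K ++ Y₁) ↭ (B ++ (W ++ K ++ Y₁) ++ K)
        toResult = solve 4 (λ b w k y → ((b ⊕ (w ⊕ k)) ⊕ (k ⊕ y)) ⊜ (b ⊕ ((w ⊕ (k ⊕ y)) ⊕ k))) ↭-refl B W K Y₁

    -- A rule applicable to single-copy premisses in every context extending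
    -- B is applicable to multi-copy premisses in context B: peel the first
    -- premiss, supplying the others by weakening.
    multi-copy-rule : ∀ Cs B → (∀ W → All (λ C → Der₀ (B ++ W ++ [ C ])) Cs → UpTo K (B ++ W ++ K)) →
      All (MultiPremiss B) Cs → UpTo K (B ++ K)
    multi-copy-rule []       B rule []             = rule [] []
    multi-copy-rule (C ∷ Cs) B rule ((a , d) ∷ ps) = peel step a [] d
      where
      step : ∀ W → Der₀ (B ++ W ++ [ C ]) → UpTo K (B ++ W ++ K)
      step W d₁ = upTo-rearrange (assoc K)
        (multi-copy-rule Cs (B ++ W) rest (All.map (multiPremiss-extend W ↭-refl) ps))
        where
        assoc : ∀ T → (B ++ W ++ T) ↭ ((B ++ W) ++ T)
        assoc T = solve 3 (λ b w t → (b ⊕ (w ⊕ t)) ⊜ ((b ⊕ w) ⊕ t)) ↭-refl B W T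
        assoc₃ : ∀ W' T → (B ++ (W ++ W') ++ T) ↭ ((B ++ W) ++ W' ++ T)
        assoc₃ W' T = solve 4 (λ b w v t → (b ⊕ ((w ⊕ v) ⊕ t)) ⊜ ((b ⊕ w) ⊕ (v ⊕ t))) ↭-refl B W W' T
        rest : ∀ W' → All (λ C' → Der₀ ((B ++ W) ++ W' ++ [ C' ])) Cs → UpTo K ((B ++ W) ++ W' ++ K)
        rest W' ds = upTo-rearrange (↭-sym (assoc₃ W' K))
          (rule (W ++ W') (extend₀ W' weakened d₁ ∷ All.map (rearrange₀ (assoc₃ W' _)) ds))
          where
          weakened : (B ++ (W ++ W') ++ [ C ]) ↭ ((B ++ W ++ [ C ]) ++ W')
          weakened = solve 4 (λ b w v c → (b ⊕ ((w ⊕ v) ⊕ c)) ⊜ ((b ⊕ (w ⊕ c)) ⊕ v)) ↭-refl B W W' [ C ]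

  rule-exact : ∀ {Cs K} → Rule Cs K → ∀ B W → All (λ C → Der₀ (B ++ W ++ [ C ])) Cs → UpTo K (B ++ W ++ K)
  rule-exact {K = K} rule B W ds =
    [] , [] , rearrange₀ assocK (rule (B ++ W) (All.map (rearrange₀ (assoc [ _ ])) ds))
    where
    assoc : ∀ T → ((B ++ W) ++ T) ↭ (B ++ W ++ T)
    assoc T = solve 3 (λ b w t → ((b ⊕ w) ⊕ t) ⊜ (b ⊕ (w ⊕ t))) ↭-refl B W T
    assocK : ((B ++ W ++ K) ++ []) ↭ ((B ++ W) ++ K)
    assocK = solve 3 (λ b w k → ((b ⊕ (w ⊕ k)) ⊕ id) ⊜ ((b ⊕ w) ⊕ k)) ↭-refl B W K

  rule-up-to-copies : ∀ {Cs K G H} → Rule Cs K → H ≈H (G ++ K) →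
    All (λ C → UpTo (G ++ [ C ]) (G ++ [ C ])) Cs → UpTo H H
  rule-up-to-copies {Cs} {K} {G} {H} rule H≈ ps with common-context (All.map premiss-copies ps)
  ... | A , cA , qs =
    upTo-absorb (All.map (∈-left H≈) cA)
      (upTo-transport eq (upTo-mono (∈-right H≈) (multi-copy-rule Cs (G ++ A) (rule-exact rule (G ++ A)) qs)))
    where
    eq : (H ++ A) ≈H ((G ++ A) ++ K)
    eq = ≈H-trans (≈H-++ H≈ ≈H-refl)
      (↭⇒≈H (solve 3 (λ g k a → ((g ⊕ k) ⊕ a) ⊜ ((g ⊕ a) ⊕ k)) ↭-refl G K A))

  mutual
    up-to-copies : ∀ {H} → Der ℍ H → UpTo H H
    up-to-copies (lj0 G r H≈)       = rule-up-to-copies (lj0-rule r) H≈ []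
    up-to-copies (lj1 G r H≈ d)     = rule-up-to-copies (lj1-rule r) H≈ (up-to-copies d ∷ [])
    up-to-copies (lj2 G r H≈ d₁ d₂) =
      rule-up-to-copies (lj2-rule r) H≈ (up-to-copies d₁ ∷ up-to-copies d₂ ∷ [])
    up-to-copies (hr G h H≈ ds)     = rule-up-to-copies (hr-rule h) H≈ (up-to-copies-all ds)
    up-to-copies (ew G S H≈ d)      =
      upTo-transport H≈ (upTo-weaken [ S ] (upTo-mono (∈-left H≈) (up-to-copies d)))
    up-to-copies {H} (ec G S H≈ d)  =
      upTo-transport H≈ (upTo-absorb (∈-right H≈ (here ≈S-refl) ∷ [])
        (upTo-rearrange (solve 2 (λ g s → ((g ⊕ s) ⊕ s) ⊜ (g ⊕ (s ⊕ s))) ↭-refl G [ S ])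
          (upTo-mono contracted (up-to-copies d))))
      where
      contracted : ∀ {x} → x ∈ (G ++ S ∷ S ∷ []) → x ∈ H
      contracted m with ∈-++⁻ Sequents G m
      ... | inj₁ x∈G                 = ∈-left H≈ x∈G
      ... | inj₂ (here x≈S)          = ∈-right H≈ (here x≈S)
      ... | inj₂ (there (here x≈S))  = ∈-right H≈ (here x≈S)

    up-to-copies-all : ∀ {G Cs} → Ders ℍ G Cs → All (λ C → UpTo (G ++ [ C ]) (G ++ [ C ])) Cs
    up-to-copies-all []       = []
    up-to-copies-all (d ∷ ds) = up-to-copies d ∷ up-to-copies-all ds

  contract-copy : ∀ {Z x} → x ∈ Z → (d : Der ℍ (Z ++ [ x ])) → RankZero d → Σ (Der ℍ Z) RankZero
  contract-copy {Z} {x} x∈Z d rz with ∈-∃++ Sequents x∈Z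
  ... | Z₁ , Z₂ , w , x≈w , Z≋ =
    ec (Z₁ ++ Z₂) w conclusion (transport premiss d) , refl ∷ transport-RankZero premiss d rz
    where
    conclusion : Z ≈H ((Z₁ ++ Z₂) ++ [ w ])
    conclusion = ≈H-trans (≋⇒≈H Z≋)
      (↭⇒≈H (solve 3 (λ a w b → (a ⊕ (w ⊕ b)) ⊜ ((a ⊕ b) ⊕ w)) ↭-refl Z₁ [ w ] Z₂))
    premiss : ((Z₁ ++ Z₂) ++ w ∷ w ∷ []) ≈H (Z ++ [ x ])
    premiss = ≈H-trans
      (↭⇒≈H (solve 2 (λ z w → (z ⊕ (w ⊕ w)) ⊜ ((z ⊕ w) ⊕ w)) ↭-refl (Z₁ ++ Z₂) [ w ]))
      (≈H-++ (≈H-sym conclusion) (≋⇒≈H (≈S-sym x≈w ∷ [])))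

  contract : ∀ {H} Y → Copies H Y → (d : Der ℍ (H ++ Y)) → RankZero d → Σ (Der ℍ H) RankZero
  contract {H} [] [] d rz = transport q d , transport-RankZero q d rz
    where
    q : H ≈H (H ++ [])
    q = ↭⇒≈H (solve 1 (λ h → h ⊜ (h ⊕ id)) ↭-refl H)
  contract {H} (y ∷ Y) (y∈H ∷ cY) d rz =
    uncurry (contract-copy y∈H)
      (contract Y (All.map (∈-++⁺ˡ Sequents) cY) (transport q d) (transport-RankZero q d rz))
    where
    q : ((H ++ [ y ]) ++ Y) ≈H (H ++ y ∷ Y)
    q = ↭⇒≈H (solve 3 (λ h y ys → ((h ⊕ y) ⊕ ys) ⊜ (h ⊕ (y ⊕ ys))) ↭-refl H [ y ] Y)

  contract-all : ∀ {H} → UpTo H H → Σ (Der ℍ H) RankZero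
  contract-all (Y , cY , d , free) = contract Y cY d (ECFree⇒RankZero d free)

lemma4 : (ℍ : HRules) {H : HSeq} → Der ℍ H →
    Σ (Der ℍ H) (λ D' → All (λ r → r ≡ 0) (ecRanks D'))
lemma4 ℍ d = contract-all (up-to-copies d)
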